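{- Let $D$ and $H$ be finite simple digraphs with $H\subseteq D$ (i.e. $H$ is a subgraph of $D$). Then $\mathrm{NCW}_\emptyset(H)\le\mathrm{NCW}_\emptyset(D)$.
   Context: An abstract digraph decomposition of $D$ is a triple $(T,\beta,\gamma)$ with $T$ a rooted directed tree (edges directed away from the root), $\beta:V(T)\to 2^{V(D)}$, $\gamma:E(T)\to 2^{V(D)}$, $\bigcup_t\beta(t)=V(D)$. Let $\Gamma(t)=\beta(t)\cup\bigcup_{e\text{ incident with }t}\gamma(e)$, $T_t$ the subtree of nodes reachable from $t$, $\beta(T_t)=\bigcup_{t'\in V(T_t)}\beta(t')$; width $=\max_t|\Gamma(t)|-1$. An $\mathrm{NCW}_\emptyset$-directed tree decomposition is an abstract digraph decomposition such that (1) $\{\beta(t)\}$ is a partition of $V(D)$ into possibly empty sets with $\beta$ of the root nonempty, and (2) for every $e=(s,t)\in E(T)$ there is no closed walk in $D-\gamma(e)$ containing a vertex of $\beta(T_t)$ and a vertex of $V(D)-\beta(T_t)$. $\mathrm{NCW}_\emptyset(D)$ is the minimum width of such a decomposition. -}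

module Defs where

open import Data.Nat using (ℕ; zero; suc; _+_; _≤_; _<_)
open import Data.Fin using (Fin; zero; suc)
open import Data.Bool using (Bool; true; false; _∨_; _∧_; not; if_then_else_)
open import Data.List using (List; []; _∷_; [_])
open import Data.List.Membership.Propositional using (_∈_)
open import Data.Product using (Σ; _×_; _,_; ∃; ∃-syntax)
open import Relation.Nullary using (¬_)
open import Relation.Binary.PropositionalEquality using (_≡_; _≢_)
open import Function.Definitions using (Injective)

-- Finite simple digraph on vertex set Fin n: arc relation as a Boolean
-- matrix (so no parallel arcs), and no loops.
record Digraph (n : ℕ) : Set where
  field
    arc   : Fin n → Fin n → Bool
    loopless : ∀ v → arc v v ≡ false
open Digraph public

-- H (on Fin m) is a subgraph of D (on Fin n): an injective vertex map
-- sending arcs of H to arcs of D (subgraph up to relabelling of vertices).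
record Subgraph {m n : ℕ} (H : Digraph m) (D : Digraph n) : Set where
  field
    emb     : Fin m → Fin n
    emb-inj : Injective _≡_ _≡_ emb
    emb-arc : ∀ u v → arc H u v ≡ true → arc D (emb u) (emb v) ≡ true

anyFin : ∀ {k} → (Fin k → Bool) → Bool
anyFin {zero}  p = false
anyFin {suc k} p = p zero ∨ anyFin (λ i → p (suc i))

countFin : ∀ {k} → (Fin k → Bool) → ℕ
countFin {zero}  p = 0
countFin {suc k} p = (if p zero then 1 else 0) + countFin (λ i → p (suc i))

eqFin? : ∀ {k} → Fin k → Fin k → Bool
eqFin? zero    zero    = true
eqFin? zero    (suc j) = false
eqFin? (suc i) zero    = false
eqFin? (suc i) (suc j) = eqFin? i j

-- Rooted directed tree on node set Fin k: every non-root node t has a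
-- parent, and the tree arc is (parent t , t).  Acyclicity (hence every
-- node reaches the root) is witnessed by a height strictly decreasing
-- along parents.
record RootedTree (k : ℕ) : Set where
  field
    root   : Fin k
    parent : Fin k → Fin k          -- value at the root is irrelevant
    height : Fin k → ℕ
    height-dec : ∀ t → t ≢ root → height (parent t) < height t
open RootedTree public

isArcHead : ∀ {k} → RootedTree k → Fin k → Bool
isArcHead T t = not (eqFin? t (root T))

isChild : ∀ {k} → RootedTree k → Fin k → Fin k → Bool
isChild T c t = isArcHead T c ∧ eqFin? (parent T c) t

data Desc {k} (T : RootedTree k) (t : Fin k) : Fin k → Set where
  here  : Desc T t t
  there : ∀ {c} → c ≢ root T → Desc T t (parent T c) → Desc T t c

-- Abstract digraph decomposition of a digraph on Fin n.  The arc of T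
-- with head t (t ≠ root) is identified with t; γ t is its guard
-- (γ (root T) is unused).
record Decomposition (n : ℕ) : Set where
  field
    nodes : ℕ
    tree  : RootedTree nodes
    β     : Fin nodes → Fin n → Bool
    γ     : Fin nodes → Fin n → Bool
open Decomposition public

Γ : ∀ {n} (W : Decomposition n) → Fin (nodes W) → Fin n → Bool
Γ W t v = β W t v
        ∨ (isArcHead (tree W) t ∧ γ W t v)
        ∨ anyFin (λ c → isChild (tree W) c t ∧ γ W c v)

-- width(W) ≤ w  (width = max_t |Γ(t)| - 1)
WidthAtMost : ∀ {n} → Decomposition n → ℕ → Set
WidthAtMost W w = ∀ t → countFin (Γ W t) ≤ suc w

InBelow : ∀ {n} (W : Decomposition n) → Fin (nodes W) → Fin n → Set
InBelow W t v = ∃[ t' ] (Desc (tree W) t t' × β W t' v ≡ true)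

data WalkAvoid {n} (D : Digraph n) (X : Fin n → Bool)
     : Fin n → Fin n → List (Fin n) → Set where
  single : ∀ {v} → X v ≡ false → WalkAvoid D X v v [ v ]
  step   : ∀ {u v w vs} → X u ≡ false → arc D u v ≡ true →
           WalkAvoid D X v w vs → WalkAvoid D X u w (u ∷ vs)

ClosedWalkThrough : ∀ {n} → Digraph n → (Fin n → Bool) → Fin n → Fin n → Set
ClosedWalkThrough D X a b =
  ∃[ v ] ∃[ vs ] (WalkAvoid D X v v vs × a ∈ vs × b ∈ vs)

record IsNCWDecomp {n} (D : Digraph n) (W : Decomposition n) : Set where
  field
    partition-cover  : ∀ v → ∃[ t ] (β W t v ≡ true)
    partition-unique : ∀ v t t' → β W t v ≡ true → β W t' v ≡ true → t ≡ t'
    root-nonempty    : ∃[ v ] (β W (root (tree W)) v ≡ true)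
    guarded : ∀ t → t ≢ root (tree W) → ∀ a b →
              InBelow W t a → ¬ InBelow W t b →
              ¬ ClosedWalkThrough D (γ W t) a b

NCW≤ : ∀ {n} → Digraph n → ℕ → Set
NCW≤ D w = Σ (Decomposition _) λ W → IsNCWDecomp D W × WidthAtMost W w

-- Restricting every bag and every guard of an NCW_∅-decomposition of D to
-- the vertices of H gives a decomposition of H of no larger width in which
-- every closed walk of H - γ(e) is a closed walk of D - γ(e).  The only
-- condition that can fail is that the root bag becomes empty.  This is
-- repaired by moving the root, one tree arc at a time, towards a node whose
-- bag is nonempty: reversing the arc (r , c) turns the new subtree of r into
-- the complement of the old subtree of c, and the guard condition is
-- symmetric in a subtree and its complement, so it survives with the same
-- guard on the reversed arc; the guards incident with each node, and hence
-- the width, do not change.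
module Submission where

open import Defs
open import Data.Nat using (ℕ; zero; suc; _+_; _≤_; _<_; z≤n; z<s; s<s)
open import Data.Nat.Properties
  using (≤-refl; ≤-trans; +-mono-≤; suc-injective; module ≤-Reasoning; +-commutativeSemigroup)
open import Data.Nat.Induction using (<-wellFounded)
open import Algebra.Properties.CommutativeSemigroup +-commutativeSemigroup using (x∙yz≈y∙xz)
open import Data.Fin using (Fin; zero; suc; punchIn; punchOut; _≟_)
open import Data.Fin.Properties using (punchIn-punchOut; punchOut-injective)
import Data.Fin.Properties as Fin
open import Data.Bool using (Bool; true; false; _∨_; _∧_; not; if_then_else_)
open import Data.List using (map)
open import Data.List.Membership.Propositional.Properties using (∈-map⁺)
open import Data.Product using (Σ; _×_; _,_; ∃-syntax; proj₁; proj₂)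
open import Data.Sum using (_⊎_; inj₁; inj₂)
import Data.Sum as Sum
open import Data.Empty using (⊥-elim)
open import Function using (_∘_; id)
open import Function.Definitions using (Injective)
open import Induction.WellFounded using (Acc; acc)
open import Relation.Nullary using (¬_; yes; no; does)
open import Relation.Nullary.Decidable using (dec-true; dec-false)
open import Relation.Binary.PropositionalEquality

private
  variable
    k m n : ℕ

∨-true⁻ : ∀ x {y} → x ∨ y ≡ true → x ≡ true ⊎ y ≡ true
∨-true⁻ true  _ = inj₁ refl
∨-true⁻ false e = inj₂ e

∨-trueˡ : ∀ {x} y → x ≡ true → x ∨ y ≡ true
∨-trueˡ y refl = refl

∨-trueʳ : ∀ x {y} → y ≡ true → x ∨ y ≡ true
∨-trueʳ true  _ = refl
∨-trueʳ false e = e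

∧-true⁻ : ∀ {x y} → x ∧ y ≡ true → x ≡ true × y ≡ true
∧-true⁻ {true} e = refl , e

∧-true⁺ : ∀ {x y} → x ≡ true → y ≡ true → x ∧ y ≡ true
∧-true⁺ refl e = e

eqFin?-sound : {i j : Fin k} → eqFin? i j ≡ true → i ≡ j
eqFin?-sound {i = zero}  {zero}  _ = refl
eqFin?-sound {i = suc i} {suc j} e = cong suc (eqFin?-sound e)

eqFin?-refl : (i : Fin k) → eqFin? i i ≡ true
eqFin?-refl zero    = refl
eqFin?-refl (suc i) = eqFin?-refl i

not-eqFin?⁻ : {i j : Fin k} → not (eqFin? i j) ≡ true → i ≢ j
not-eqFin?⁻ {i = zero}  {zero}  () _
not-eqFin?⁻ {i = suc i} {suc j} e  i≡j = not-eqFin?⁻ e (Fin.suc-injective i≡j)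

not-eqFin?⁺ : {i j : Fin k} → i ≢ j → not (eqFin? i j) ≡ true
not-eqFin?⁺ {i = zero}  {zero}  i≢j = ⊥-elim (i≢j refl)
not-eqFin?⁺ {i = zero}  {suc j} _   = refl
not-eqFin?⁺ {i = suc i} {zero}  _   = refl
not-eqFin?⁺ {i = suc i} {suc j} i≢j = not-eqFin?⁺ (i≢j ∘ cong suc)

anyFin-true⁻ : (p : Fin k → Bool) → anyFin p ≡ true → ∃[ i ] p i ≡ true
anyFin-true⁻ {suc k} p e with ∨-true⁻ (p zero) e
... | inj₁ p0 = zero , p0
... | inj₂ ps with anyFin-true⁻ (p ∘ suc) ps
...   | i , pi = suc i , pi

anyFin-true⁺ : (p : Fin k → Bool) (i : Fin k) → p i ≡ true → anyFin p ≡ true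
anyFin-true⁺ p zero    e = ∨-trueˡ _ e
anyFin-true⁺ p (suc i) e = ∨-trueʳ (p zero) (anyFin-true⁺ (p ∘ suc) i e)

bit : Bool → ℕ
bit b = if b then 1 else 0

bit-mono : ∀ {x y} → (x ≡ true → y ≡ true) → bit x ≤ bit y
bit-mono {false} _   = z≤n
bit-mono {true}  x⇒y rewrite x⇒y refl = ≤-refl

countFin-punchIn : (q : Fin (suc k) → Bool) (i : Fin (suc k)) →
                   countFin q ≡ bit (q i) + countFin (q ∘ punchIn i)
countFin-punchIn         q zero    = refl
countFin-punchIn {suc k} q (suc i) = begin
  bit (q zero) + countFin (q ∘ suc)
    ≡⟨ cong (bit (q zero) +_) (countFin-punchIn (q ∘ suc) i) ⟩
  bit (q zero) + (bit (q (suc i)) + countFin (q ∘ suc ∘ punchIn i))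
    ≡⟨ x∙yz≈y∙xz (bit (q zero)) (bit (q (suc i))) _ ⟩
  bit (q (suc i)) + (bit (q zero) + countFin (q ∘ suc ∘ punchIn i))
    ∎
  where open ≡-Reasoning

-- The first point is sent to j; the remaining points are sent injectively
-- into the complement of j, which punchIn j enumerates.
countFin-≤-injection : {q : Fin m → Bool} {p : Fin n → Bool} (f : Fin m → Fin n) →
                       Injective _≡_ _≡_ f → (∀ x → q x ≡ true → p (f x) ≡ true) →
                       countFin q ≤ countFin p
countFin-≤-injection {zero}                f _ _ = z≤n
countFin-≤-injection {suc m} {zero}        f _ _ with () ← f zero
countFin-≤-injection {suc m} {suc n} {q} {p} f f-inj q⇒p = begin
  bit (q zero) + countFin (q ∘ suc)   ≤⟨ +-mono-≤ (bit-mono (q⇒p zero)) rest ⟩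
  bit (p j) + countFin (p ∘ punchIn j) ≡⟨ countFin-punchIn p j ⟨
  countFin p                          ∎
  where
  open ≤-Reasoning
  j = f zero
  j≢ : ∀ x → j ≢ f (suc x)
  j≢ x = (λ ()) ∘ f-inj
  g : Fin m → Fin n
  g x = punchOut (j≢ x)
  g-inj : Injective _≡_ _≡_ g
  g-inj = Fin.suc-injective ∘ f-inj ∘ punchOut-injective (j≢ _) (j≢ _)
  rest : countFin (q ∘ suc) ≤ countFin (p ∘ punchIn j)
  rest = countFin-≤-injection g g-inj λ x qx →
    subst (λ y → p y ≡ true) (sym (punchIn-punchOut (j≢ x))) (q⇒p (suc x) qx)

countFin-mono : {q p : Fin k → Bool} → (∀ x → q x ≡ true → p x ≡ true) → countFin q ≤ countFin p
countFin-mono = countFin-≤-injection id id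

Incident : RootedTree k → Fin k → Fin k → Set
Incident T e t = e ≢ root T × (e ≡ t ⊎ parent T e ≡ t)

module _ (T : RootedTree k) where

  pathLength : ∀ {t x} → Desc T t x → ℕ
  pathLength here        = 0
  pathLength (there _ d) = suc (pathLength d)

  there-≡ : ∀ {t x y} → x ≢ root T → parent T x ≡ y → Desc T t y → Desc T t x
  there-≡ x≢r refl d = there x≢r d

  pathLength-there-≡ : ∀ {t x y} (x≢r : x ≢ root T) (e : parent T x ≡ y) (d : Desc T t y) →
                       pathLength (there-≡ x≢r e d) ≡ suc (pathLength d)
  pathLength-there-≡ _ refl _ = refl

  Desc-to-root⇒≡ : ∀ {t x} → Desc T t x → x ≡ root T → t ≡ x
  Desc-to-root⇒≡ here         _   = refl
  Desc-to-root⇒≡ (there x≢r _) x≡r = ⊥-elim (x≢r x≡r)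

  pathLength-to-root : ∀ {t x} (d : Desc T t x) → x ≡ root T → pathLength d ≡ 0
  pathLength-to-root here          _   = refl
  pathLength-to-root (there x≢r _) x≡r = ⊥-elim (x≢r x≡r)

  root-Desc : ∀ x → Desc T (root T) x
  root-Desc x = go x (<-wellFounded (height T x))
    where
    go : ∀ x → Acc _<_ (height T x) → Desc T (root T) x
    go x (acc rs) with x ≟ root T
    ... | yes refl = here
    ... | no  x≢r  = there x≢r (go (parent T x) (rs (height-dec T x x≢r)))

  splitRootPath : ∀ {x} (d : Desc T (root T) x) → x ≢ root T →
                  ∃[ c ] (c ≢ root T × parent T c ≡ root T ×
                          Σ (Desc T c x) λ dc → pathLength d ≡ suc (pathLength dc))
  splitRootPath here x≢r = ⊥-elim (x≢r refl)
  splitRootPath (there {x} x≢r d) _ with parent T x ≟ root T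
  ... | yes p≡r = x , x≢r , p≡r , here , cong suc (pathLength-to-root d p≡r)
  ... | no  p≢r with splitRootPath d p≢r
  ...   | c , c≢r , pc≡r , dc , len = c , c≢r , pc≡r , there x≢r dc , cong suc len

module Reroot (T : RootedTree k) {c : Fin k} (c≢r : c ≢ root T) (pc≡r : parent T c ≡ root T) where

  r : Fin k
  r = root T

  opaque
    parent′ : Fin k → Fin k
    parent′ x = if does (x ≟ r) then c else parent T x

    height′ : Fin k → ℕ
    height′ x = if does (x ≟ c) then 0 else suc (height T x)

    -- In the rerooted tree the arc entering x is the old arc entering arcOf x.
    arcOf : Fin k → Fin k
    arcOf x = if does (x ≟ r) then c else x

    parent′-r : parent′ r ≡ c
    parent′-r rewrite dec-true (r ≟ r) refl = refl

    parent′-o : ∀ {x} → x ≢ r → parent′ x ≡ parent T x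
    parent′-o {x} x≢r rewrite dec-false (x ≟ r) x≢r = refl

    arcOf-r : arcOf r ≡ c
    arcOf-r rewrite dec-true (r ≟ r) refl = refl

    arcOf-o : ∀ {x} → x ≢ r → arcOf x ≡ x
    arcOf-o {x} x≢r rewrite dec-false (x ≟ r) x≢r = refl

    height′-c : height′ c ≡ 0
    height′-c rewrite dec-true (c ≟ c) refl = refl

    height′-o : ∀ {x} → x ≢ c → height′ x ≡ suc (height T x)
    height′-o {x} x≢c rewrite dec-false (x ≟ c) x≢c = refl

  height′-dec : ∀ t → t ≢ c → height′ (parent′ t) < height′ t
  height′-dec t t≢c rewrite height′-o t≢c with t ≟ r
  ... | yes refl rewrite parent′-r | height′-c = z<s
  ... | no  t≢r rewrite parent′-o t≢r with parent T t ≟ c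
  ...   | yes p≡c rewrite p≡c | height′-c = z<s
  ...   | no  p≢c rewrite height′-o p≢c = s<s (height-dec T t t≢r)

  T′ : RootedTree k
  T′ = record { root = c ; parent = parent′ ; height = height′ ; height-dec = height′-dec }

  Incident′⇒Incident : ∀ {e t} → Incident T′ e t → Incident T (arcOf e) t
  Incident′⇒Incident {e} (e≢c , e-t) with e ≟ r
  ... | yes refl rewrite arcOf-r =
    c≢r , Sum.[ inj₂ ∘ trans pc≡r , inj₁ ∘ trans (sym parent′-r) ] e-t
  ... | no  e≢r  rewrite arcOf-o e≢r = e≢r , Sum.map₂ (trans (sym (parent′-o e≢r))) e-t

  Desc⁺ : ∀ {t x} → t ≢ r → (d : Desc T t x) →
          Σ (Desc T′ t x) λ d′ → pathLength T′ d′ ≡ pathLength T d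
  Desc⁺ t≢r here = here , refl
  Desc⁺ {t} t≢r (there {x} x≢r d) with Desc⁺ t≢r d
  ... | d′ , len = there-≡ T′ x≢c (parent′-o x≢r) d′
                 , trans (pathLength-there-≡ T′ x≢c (parent′-o x≢r) d′) (cong suc len)
    where
    x≢c : x ≢ c
    x≢c refl = t≢r (trans (Desc-to-root⇒≡ T d pc≡r) pc≡r)

  Desc⁻ : ∀ {t x} → t ≢ c → Desc T′ t x → Desc T t x
  Desc⁻ t≢c here = here
  Desc⁻ t≢c (there {x} _ d′) with x ≟ r
  ... | yes refl = ⊥-elim (t≢c (trans (Desc-to-root⇒≡ T′ d′ parent′-r) parent′-r))
  ... | no  x≢r  = there-≡ T x≢r (sym (parent′-o x≢r)) (Desc⁻ t≢c d′)

  Desc′-r⇒¬Desc-c : ∀ {x} → Desc T′ r x → ¬ Desc T c x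
  Desc′-r⇒¬Desc-c here d = c≢r (Desc-to-root⇒≡ T d refl)
  Desc′-r⇒¬Desc-c (there {x} x≢c d′) with x ≟ r
  ... | yes refl = λ _ → c≢r (sym (trans (Desc-to-root⇒≡ T′ d′ parent′-r) parent′-r))
  ... | no  x≢r  = λ { here → x≢c refl
                     ; (there _ d) → Desc′-r⇒¬Desc-c d′ (subst (Desc T c) (sym (parent′-o x≢r)) d) }

  Desc′-r⊎Desc-c : ∀ {x} → Desc T r x → Desc T′ r x ⊎ Desc T c x
  Desc′-r⊎Desc-c here = inj₁ here
  Desc′-r⊎Desc-c (there {x} x≢r d) with Desc′-r⊎Desc-c d | x ≟ c
  ... | inj₂ dc | _        = inj₂ (there x≢r dc)
  ... | inj₁ _  | yes refl = inj₂ here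
  ... | inj₁ d′ | no  x≢c  = inj₁ (there-≡ T′ x≢c (parent′-o x≢r) d′)

record IsUnrootedNCWDecomp {n} (D : Digraph n) (W : Decomposition n) : Set where
  field
    cover   : ∀ v → ∃[ t ] (β W t v ≡ true)
    unique  : ∀ v t t' → β W t v ≡ true → β W t' v ≡ true → t ≡ t'
    guarded : ∀ t → t ≢ root (tree W) → ∀ a b →
              InBelow W t a → ¬ InBelow W t b →
              ¬ ClosedWalkThrough D (γ W t) a b

  withRootBag : ∃[ v ] (β W (root (tree W)) v ≡ true) → IsNCWDecomp D W
  withRootBag nonempty = record { partition-cover = cover ; partition-unique = unique
                                ; root-nonempty = nonempty ; guarded = guarded }

closedWalk-swap : {D : Digraph n} {X : Fin n → Bool} {a b : Fin n} →
                  ClosedWalkThrough D X a b → ClosedWalkThrough D X b a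
closedWalk-swap (v , vs , walk , a∈ , b∈) = v , vs , walk , b∈ , a∈

Γ⁻ : ∀ (W : Decomposition n) t u → Γ W t u ≡ true →
     β W t u ≡ true ⊎ ∃[ e ] (Incident (tree W) e t × γ W e u ≡ true)
Γ⁻ W t u Γtu with ∨-true⁻ (β W t u) Γtu
... | inj₁ βtu = inj₁ βtu
... | inj₂ arcs with ∨-true⁻ (isArcHead (tree W) t ∧ γ W t u) arcs
...   | inj₁ up = let head , g = ∧-true⁻ up in
                  inj₂ (t , (not-eqFin?⁻ head , inj₁ refl) , g)
...   | inj₂ down with anyFin-true⁻ _ down
...     | e , child = let isChild , g = ∧-true⁻ child
                          head , p≡t = ∧-true⁻ {isArcHead (tree W) e} isChild in
                      inj₂ (e , (not-eqFin?⁻ head , inj₂ (eqFin?-sound p≡t)) , g)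

Γ⁺ : ∀ (W : Decomposition n) t u →
     β W t u ≡ true ⊎ ∃[ e ] (Incident (tree W) e t × γ W e u ≡ true) → Γ W t u ≡ true
Γ⁺ W t u (inj₁ βtu) = ∨-trueˡ _ βtu
Γ⁺ W t u (inj₂ (t , (t≢r , inj₁ refl) , g)) =
  ∨-trueʳ (β W t u) (∨-trueˡ _ (∧-true⁺ (not-eqFin?⁺ t≢r) g))
Γ⁺ W t u (inj₂ (e , (e≢r , inj₂ refl) , g)) =
  ∨-trueʳ (β W t u) (∨-trueʳ (isArcHead (tree W) t ∧ γ W t u)
    (anyFin-true⁺ (λ x → isChild (tree W) x t ∧ γ W x u) e
      (∧-true⁺ (∧-true⁺ (not-eqFin?⁺ e≢r) (eqFin?-refl t)) g)))

module RerootDecomp {D : Digraph n} (W : Decomposition n) (U : IsUnrootedNCWDecomp D W)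
                    {c : Fin (nodes W)} (c≢r : c ≢ root (tree W))
                    (pc≡r : parent (tree W) c ≡ root (tree W)) where

  open IsUnrootedNCWDecomp U
  open Reroot (tree W) c≢r pc≡r public

  W′ : Decomposition n
  W′ = record { nodes = nodes W ; tree = T′ ; β = β W ; γ = γ W ∘ arcOf }

  InBelow′⇒InBelow : ∀ {t a} → t ≢ c → InBelow W′ t a → InBelow W t a
  InBelow′⇒InBelow t≢c (t′ , d′ , βa) = t′ , Desc⁻ t≢c d′ , βa

  InBelow⇒InBelow′ : ∀ {t a} → t ≢ r → InBelow W t a → InBelow W′ t a
  InBelow⇒InBelow′ t≢r (t′ , d , βa) = t′ , proj₁ (Desc⁺ t≢r d) , βa

  InBelow′-r⇒¬InBelow-c : ∀ {a} → InBelow W′ r a → ¬ InBelow W c a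
  InBelow′-r⇒¬InBelow-c {a} (t′ , d′ , βa) (t″ , d″ , βa′) with unique a t′ t″ βa βa′
  ... | refl = Desc′-r⇒¬Desc-c d′ d″

  ¬InBelow′-r⇒InBelow-c : ∀ {b} → ¬ InBelow W′ r b → InBelow W c b
  ¬InBelow′-r⇒InBelow-c {b} ¬below with cover b
  ... | t , βb with Desc′-r⊎Desc-c (root-Desc (tree W) t)
  ...   | inj₁ d′ = ⊥-elim (¬below (t , d′ , βb))
  ...   | inj₂ dc = t , dc , βb

  guarded′ : ∀ t → t ≢ c → ∀ a b → InBelow W′ t a → ¬ InBelow W′ t b →
             ¬ ClosedWalkThrough D (γ W′ t) a b
  guarded′ t t≢c a b below ¬below walk with t ≟ r
  ... | yes refl =
    guarded c c≢r b a (¬InBelow′-r⇒InBelow-c ¬below) (InBelow′-r⇒¬InBelow-c below)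
      (closedWalk-swap (subst (λ e → ClosedWalkThrough D (γ W e) a b) arcOf-r walk))
  ... | no t≢r =
    guarded t t≢r a b (InBelow′⇒InBelow t≢c below) (¬below ∘ InBelow⇒InBelow′ t≢r)
      (subst (λ e → ClosedWalkThrough D (γ W e) a b) (arcOf-o t≢r) walk)

  isUnrooted′ : IsUnrootedNCWDecomp D W′
  isUnrooted′ = record { cover = cover ; unique = unique ; guarded = guarded′ }

  width′ : ∀ {w} → WidthAtMost W w → WidthAtMost W′ w
  width′ wd t = ≤-trans (countFin-mono Γ′⊆Γ) (wd t)
    where
    Γ′⊆Γ : ∀ u → Γ W′ t u ≡ true → Γ W t u ≡ true
    Γ′⊆Γ u = Γ⁺ W t u
           ∘ Sum.map₂ (λ (e , inc , g) → arcOf e , Incident′⇒Incident inc , g)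
           ∘ Γ⁻ W′ t u

rootAtBag : ∀ {D : Digraph n} {w v} len (W : Decomposition n) → IsUnrootedNCWDecomp D W →
            WidthAtMost W w → ∀ {t} → β W t v ≡ true →
            (d : Desc (tree W) (root (tree W)) t) → pathLength (tree W) d ≡ len → NCW≤ D w
rootAtBag _ W U wd βv here _ = W , IsUnrootedNCWDecomp.withRootBag U (_ , βv) , wd
rootAtBag (suc len) W U wd βv d@(there t≢r _) len≡
  with splitRootPath (tree W) d t≢r
... | c , c≢r , pc≡r , dc , split =
  let open RerootDecomp W U c≢r pc≡r
      dc′ , same-length = Desc⁺ c≢r dc
  in rootAtBag len W′ isUnrooted′ (width′ wd) βv dc′
               (trans same-length (suc-injective (trans (sym split) len≡)))

module Restrict {D : Digraph n} {H : Digraph m} (S : Subgraph H D) where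
  open Subgraph S

  restrict : Decomposition n → Decomposition m
  restrict W = record { nodes = nodes W ; tree = tree W
                      ; β = λ t → β W t ∘ emb ; γ = λ t → γ W t ∘ emb }

  mapWalk : ∀ {X u v vs} → WalkAvoid H (X ∘ emb) u v vs → WalkAvoid D X (emb u) (emb v) (map emb vs)
  mapWalk (single Xv)       = single Xv
  mapWalk (step Xu uv walk) = step Xu (emb-arc _ _ uv) (mapWalk walk)

  mapClosedWalk : ∀ {X a b} → ClosedWalkThrough H (X ∘ emb) a b → ClosedWalkThrough D X (emb a) (emb b)
  mapClosedWalk (v , vs , walk , a∈ , b∈) =
    emb v , map emb vs , mapWalk walk , ∈-map⁺ emb a∈ , ∈-map⁺ emb b∈

  restrict-isUnrooted : ∀ {W} → IsNCWDecomp D W → IsUnrootedNCWDecomp H (restrict W)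
  restrict-isUnrooted I = record
    { cover   = partition-cover ∘ emb
    ; unique  = partition-unique ∘ emb
    ; guarded = λ t t≢r a b below ¬below →
                  guarded t t≢r (emb a) (emb b) below ¬below ∘ mapClosedWalk
    }
    where open IsNCWDecomp I

  -- Γ (restrict W) t is Γ W t ∘ emb by computation.
  restrict-width : ∀ {W w} → WidthAtMost W w → WidthAtMost (restrict W) w
  restrict-width {W} wd t =
    ≤-trans (countFin-≤-injection {q = Γ (restrict W) t} {p = Γ W t} emb emb-inj λ _ Γu → Γu)
            (wd t)

lemma5p2 : ∀ {m n} (D : Digraph n) (H : Digraph (suc m)) → Subgraph H D →
    ∀ w → NCW≤ D w → NCW≤ H w
lemma5p2 D H S w (W , I , wd) =
  rootAtBag _ (restrict W) U (restrict-width {W} wd) (proj₂ bag) (root-Desc (tree W) (proj₁ bag)) refl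
  where
  open Restrict S
  U = restrict-isUnrooted I
  bag = IsUnrootedNCWDecomp.cover U zero
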